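{- Let $h'$ be a Hessenberg function with degree tuple $\beta'=(\beta'_n,\ldots,\beta'_1)$. (1) For $i\in\{1,\ldots,n\}$ and any integer $d>\beta'_i$, we have $\tilde e_d(i,i+1,\ldots,n)\in J_{h'}$. (2) If $h$ is a Hessenberg function whose degree tuple $\beta$ satisfies $\beta>\beta'$, then $J_h\subseteq J_{h'}$.
   Context: A Hessenberg function is an $n$-tuple $h=(h_1,\ldots,h_n)$ of integers with $i\le h_i\le n$ and $h_i\le h_{i+1}$. Its degree tuple is $\beta=(\beta_n,\ldots,\beta_1)$ with $\beta_i=i-\#\{k:h_k<i\}$. Degree tuples are ordered componentwise: $\beta\ge\beta'$ iff $\beta_i\ge\beta'_i$ for all $i$, and $\beta>\beta'$ means $\beta\ge\beta'$, $\beta\neq\beta'$. For $S\subseteq\{1,\ldots,n\}$, $\tilde e_d(S)$ is the sum of all monomials (not necessarily squarefree) of degree $d$ in the variables $x_i$, $i\in S$ ($\tilde e_0(S)=1$), and $\tilde e_d(i,\ldots,n)$ means $S=\{i,\ldots,n\}$. $J_h$ is the ideal of $\mathbb{Z}[x_1,\ldots,x_n]$ generated by $\tilde e_{\beta_i}(i,\ldots,n)$, $i=1,\ldots,n$. -}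

module Defs where

open import Data.Nat as ℕ using (ℕ; zero; suc; _≤_; _<_; _∸_; _≡ᵇ_; _<ᵇ_)
open import Data.Integer as ℤ using (ℤ)
open import Data.Bool using (Bool; true; false; _∧_; if_then_else_)
open import Data.Fin using (Fin; toℕ)
open import Data.List as L using (List; []; _∷_; _++_; concatMap; filterᵇ; upTo; allFin; length)
open import Data.Vec as V using (Vec; []; _∷_)
open import Data.Vec.Properties using (≡-dec)
open import Data.Product using (_×_; _,_; Σ)
open import Relation.Nullary using (¬_; does)
open import Relation.Binary.PropositionalEquality using (_≡_)

-- Variable x_{j+1} corresponds to index j : Fin n.
-- A monomial is its exponent vector; a polynomial is a formal finite
-- ℤ-linear combination of monomials (list of terms).  Two polynomials
-- are equal (_≈P_) iff all their coefficients agree; this is exactly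
-- the polynomial ring as a setoid.

Mono : ℕ → Set
Mono n = Vec ℕ n

Poly : ℕ → Set
Poly n = List (ℤ × Mono n)

coeff : ∀ {n} → Poly n → Mono n → ℤ
coeff [] m = ℤ.0ℤ
coeff ((c , e) ∷ p) m =
  if does (≡-dec ℕ._≟_ e m) then c ℤ.+ coeff p m else coeff p m

_≈P_ : ∀ {n} → Poly n → Poly n → Set
p ≈P q = ∀ m → coeff p m ≡ coeff q m

0P : ∀ {n} → Poly n
0P = []

_+P_ : ∀ {n} → Poly n → Poly n → Poly n
p +P q = p ++ q

_*P_ : ∀ {n} → Poly n → Poly n → Poly n
p *P q = concatMap (λ { (c , e) → L.map (λ { (d , f) → (c ℤ.* d , V.zipWith ℕ._+_ e f) }) q }) p

ΣP : ∀ {n k} → (Fin k → Poly n) → Poly n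
ΣP {k = k} f = L.foldr (λ i acc → f i +P acc) 0P (allFin k)

_∈Ideal_ : ∀ {n k} → Poly n → (Fin k → Poly n) → Set
_∈Ideal_ {n} {k} p g = Σ (Fin k → Poly n) λ c → p ≈P ΣP (λ i → c i *P g i)

allVecs : (n d : ℕ) → List (Vec ℕ n)
allVecs zero d = [] ∷ []
allVecs (suc n) d = concatMap (λ a → L.map (a ∷_) (allVecs n d)) (upTo (suc d))

zerosBelow : ∀ {n} → ℕ → Vec ℕ n → Bool
zerosBelow zero v = true
zerosBelow (suc k) [] = true
zerosBelow (suc k) (x ∷ v) = (x ≡ᵇ 0) ∧ zerosBelow k v

-- ẽ_d(i,…,n) for i = toℕ i₀ + 1, i.e. variables with index ≥ i₀
eTilde : ∀ {n} → ℕ → Fin n → Poly n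
eTilde {n} d i₀ =
  L.map (λ e → (ℤ.1ℤ , e))
    (filterᵇ (λ e → (V.sum e ≡ᵇ d) ∧ zerosBelow (toℕ i₀) e) (allVecs n d))

-- Hessenberg functions, h : Fin n → ℕ, with h j the value h_{j+1}.

record IsHessenberg (n : ℕ) (h : Fin n → ℕ) : Set where
  field
    lower : ∀ j → suc (toℕ j) ≤ h j
    upper : ∀ j → h j ≤ n
    mono  : ∀ j k → toℕ j ≤ toℕ k → h j ≤ h k

-- β_i = i − #{k : h_k < i}, for i = toℕ j + 1
degTuple : ∀ {n} → (Fin n → ℕ) → Fin n → ℕ
degTuple {n} h j =
  suc (toℕ j) ∸ length (filterᵇ (λ k → h k <ᵇ suc (toℕ j)) (allFin n))

Jgens : ∀ {n} → (Fin n → ℕ) → Fin n → Poly n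
Jgens h i = eTilde (degTuple h i) i

_∈J_ : ∀ {n} → Poly n → (Fin n → ℕ) → Set
p ∈J h = p ∈Ideal Jgens h

_≥β_ : ∀ {n} → (Fin n → ℕ) → (Fin n → ℕ) → Set
β ≥β β' = ∀ i → β' i ≤ β i

_>β_ : ∀ {n} → (Fin n → ℕ) → (Fin n → ℕ) → Set
β >β β' = β ≥β β' × ¬ (∀ i → β i ≡ β' i)

-- Splitting off the monomials divisible by x_k gives the Pascal-type recurrence
--   ẽ_{d+1}(k,…,n) = ẽ_{d+1}(k+1,…,n) + x_k ẽ_d(k,…,n),
-- and ẽ_{d+1} in no variables is 0.  For every function h' the degree tuple
-- satisfies β'_{k+1} ≤ β'_k + 1, so induction on the number of variables and on
-- d shows ẽ_d(k,…,n) ∈ J_{h'} whenever d ≥ β'_k, the case d = β'_k being a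
-- generator.  Part (2) follows because every generator ẽ_{β_i}(i,…,n) of J_h
-- has β_i ≥ β'_i.
module Submission where

open import Defs
open import Data.Nat using (ℕ; _<_)
open import Data.Fin using (Fin)
open import Data.Product using (_×_)

open import Data.Bool using (Bool; true; false; _∧_; if_then_else_; T)
open import Data.Bool.Properties using (∧-conicalˡ; ∧-conicalʳ; ∧-zeroʳ; T-≡)
open import Data.Empty using (⊥-elim)
open import Data.Fin as F using (toℕ; fromℕ<)
import Data.Fin.Properties as FP
open import Data.Integer using (ℤ; 0ℤ; 1ℤ; _+_; _*_)
import Data.Integer.Properties as ZP
open import Algebra.Properties.CommutativeSemigroup ZP.+-commutativeSemigroup using (interchange)
open import Data.List as L using (List; []; _∷_; _++_; concatMap; filterᵇ; upTo; allFin; length; foldr)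
import Data.List.Properties as LP
open import Data.List.Membership.Propositional using (_∈_; _∉_)
open import Data.List.Membership.Propositional.Properties using (∈-upTo⁺; ∈-allFin)
open import Data.List.Relation.Unary.All.Properties using (All¬⇒¬Any)
open import Data.List.Relation.Unary.Any using (here; there)
open import Data.List.Relation.Unary.Unique.Propositional using (Unique; _∷_)
open import Data.List.Relation.Unary.Unique.Propositional.Properties using (upTo⁺; allFin⁺)
open import Data.Nat as N using (suc; zero; _≤_; _∸_; _≡ᵇ_; _<ᵇ_; _≤ᵇ_; z≤n; s≤s)
import Data.Nat.Properties as NP
open import Data.Product using (_,_; proj₁; proj₂)
open import Data.Sum using (inj₁; inj₂)
open import Data.Unit using (tt)
open import Data.Vec as V using ([]; _∷_)
open import Data.Vec.Properties using (≡-dec; ∷-injective; zipWith-assoc; zipWith-identityʳ)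
open import Function using (_∘_)
open import Function.Bundles using (Equivalence)
open import Level using (0ℓ)
open import Relation.Binary.Bundles using (Setoid)
open import Relation.Binary.PropositionalEquality
import Relation.Binary.Reasoning.Setoid as SetoidReasoning
open import Relation.Nullary using (¬_; Dec; yes; no; does)

_+ᴹ_ : ∀ {n} → Mono n → Mono n → Mono n
_+ᴹ_ = V.zipWith N._+_

_∸ᴹ_ : ∀ {n} → Mono n → Mono n → Mono n
_∸ᴹ_ = V.zipWith N._∸_

_≤ᴹ_ : ∀ {n} → Mono n → Mono n → Bool
[] ≤ᴹ [] = true
(a ∷ e) ≤ᴹ (b ∷ m) = (a ≤ᵇ b) ∧ (e ≤ᴹ m)

0ᴹ : ∀ {n} → Mono n
0ᴹ = V.replicate _ 0

-- The exponent vector of x_{k+1}; it degenerates to 0ᴹ when k ≥ n.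
xᴹ : ∀ {n} → ℕ → Mono n
xᴹ {zero} _ = []
xᴹ {suc n} zero = 1 ∷ 0ᴹ
xᴹ {suc n} (suc k) = 0 ∷ xᴹ k

+ᴹ-∸ᴹ : ∀ {n} (e m : Mono n) → e ≤ᴹ m ≡ true → e +ᴹ (m ∸ᴹ e) ≡ m
+ᴹ-∸ᴹ [] [] _ = refl
+ᴹ-∸ᴹ (a ∷ e) (b ∷ m) e≤m =
  cong₂ _∷_ (NP.m+[n∸m]≡n (NP.≤ᵇ⇒≤ a b (Equivalence.from T-≡ (∧-conicalˡ _ _ e≤m))))
            (+ᴹ-∸ᴹ e m (∧-conicalʳ _ _ e≤m))

≤ᴹ-+ᴹ : ∀ {n} (e f : Mono n) → e ≤ᴹ (e +ᴹ f) ≡ true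
≤ᴹ-+ᴹ [] [] = refl
≤ᴹ-+ᴹ (a ∷ e) (b ∷ f)
  rewrite Equivalence.to T-≡ (NP.≤⇒≤ᵇ (NP.m≤m+n a b)) = ≤ᴹ-+ᴹ e f

+ᴹ-∸ᴹ-cancelˡ : ∀ {n} (e f : Mono n) → (e +ᴹ f) ∸ᴹ e ≡ f
+ᴹ-∸ᴹ-cancelˡ [] [] = refl
+ᴹ-∸ᴹ-cancelˡ (a ∷ e) (b ∷ f) = cong₂ _∷_ (NP.m+n∸m≡n a b) (+ᴹ-∸ᴹ-cancelˡ e f)

0ᴹ-≤ᴹ : ∀ {n} (m : Mono n) → 0ᴹ ≤ᴹ m ≡ true
0ᴹ-≤ᴹ [] = refl
0ᴹ-≤ᴹ (_ ∷ m) = 0ᴹ-≤ᴹ m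

∸ᴹ-0ᴹ : ∀ {n} (m : Mono n) → m ∸ᴹ 0ᴹ ≡ m
∸ᴹ-0ᴹ = zipWith-identityʳ (λ _ → refl)

-- _≈P_ unfolds to a Π-type over coeff, from which unification cannot recover
-- the polynomials; wrapping it in a record makes them inferable.
record _≋_ {n} (p q : Poly n) : Set where
  constructor coeffwise
  field coeff-≡ : p ≈P q

open _≋_ public

≋-setoid : ℕ → Setoid 0ℓ 0ℓ
≋-setoid n = record
  { Carrier = Poly n
  ; _≈_ = _≋_
  ; isEquivalence = record
    { refl = coeffwise λ _ → refl
    ; sym = λ p≋q → coeffwise λ m → sym (coeff-≡ p≋q m)
    ; trans = λ p≋q q≋r → coeffwise λ m → trans (coeff-≡ p≋q m) (coeff-≡ q≋r m)
    }
  }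

module ≋-Reasoning {n : ℕ} = SetoidReasoning (≋-setoid n)

open module ≋ {n : ℕ} = Setoid (≋-setoid n)
  using () renaming (refl to ≋-refl; reflexive to ≡⇒≋; sym to ≋-sym; trans to ≋-trans)

coeff-++ : ∀ {n} (p q : Poly n) m → coeff (p ++ q) m ≡ coeff p m + coeff q m
coeff-++ [] q m = sym (ZP.+-identityˡ _)
coeff-++ ((c , e) ∷ p) q m with does (≡-dec N._≟_ e m)
... | true = trans (cong (c +_) (coeff-++ p q m)) (sym (ZP.+-assoc c _ _))
... | false = coeff-++ p q m

++-cong : ∀ {n} {p p' q q' : Poly n} → p ≋ p' → q ≋ q' → (p ++ q) ≋ (p' ++ q')
++-cong {p = p} {p'} {q} {q'} p≋p' q≋q' = coeffwise λ m → begin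
  coeff (p ++ q) m         ≡⟨ coeff-++ p q m ⟩
  coeff p m + coeff q m    ≡⟨ cong₂ _+_ (coeff-≡ p≋p' m) (coeff-≡ q≋q' m) ⟩
  coeff p' m + coeff q' m  ≡⟨ coeff-++ p' q' m ⟨
  coeff (p' ++ q') m       ∎
  where open ≡-Reasoning

++-interchange : ∀ {n} (a b c d : Poly n) → ((a ++ b) ++ (c ++ d)) ≋ ((a ++ c) ++ (b ++ d))
++-interchange a b c d = coeffwise λ m → begin
  coeff ((a ++ b) ++ (c ++ d)) m
    ≡⟨ trans (coeff-++ (a ++ b) _ m) (cong₂ _+_ (coeff-++ a b m) (coeff-++ c d m)) ⟩
  (coeff a m + coeff b m) + (coeff c m + coeff d m)
    ≡⟨ interchange (coeff a m) (coeff b m) (coeff c m) (coeff d m) ⟩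
  (coeff a m + coeff c m) + (coeff b m + coeff d m)
    ≡⟨ trans (coeff-++ (a ++ c) _ m) (cong₂ _+_ (coeff-++ a c m) (coeff-++ b d m)) ⟨
  coeff ((a ++ c) ++ (b ++ d)) m ∎
  where open ≡-Reasoning

termMul : ∀ {n} → ℤ × Mono n → Poly n → Poly n
termMul (c , e) = L.map λ (d , f) → (c * d , e +ᴹ f)

coeff-termMul : ∀ {n} c (e : Mono n) q m → e ≤ᴹ m ≡ true →
  coeff (termMul (c , e) q) m ≡ c * coeff q (m ∸ᴹ e)
coeff-termMul c e [] m _ = sym (ZP.*-zeroʳ c)
coeff-termMul c e ((d , f) ∷ q) m e≤m
  with ≡-dec N._≟_ (e +ᴹ f) m | ≡-dec N._≟_ f (m ∸ᴹ e)
... | yes _ | yes _ =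
  trans (cong (c * d +_) (coeff-termMul c e q m e≤m)) (sym (ZP.*-distribˡ-+ c d _))
... | yes refl | no f≢ = ⊥-elim (f≢ (sym (+ᴹ-∸ᴹ-cancelˡ e f)))
... | no e+f≢m | yes refl = ⊥-elim (e+f≢m (+ᴹ-∸ᴹ e m e≤m))
... | no _ | no _ = coeff-termMul c e q m e≤m

coeff-termMul-∤ : ∀ {n} c (e : Mono n) q m → e ≤ᴹ m ≡ false →
  coeff (termMul (c , e) q) m ≡ 0ℤ
coeff-termMul-∤ c e [] m _ = refl
coeff-termMul-∤ c e ((d , f) ∷ q) m e≰m with ≡-dec N._≟_ (e +ᴹ f) m
... | yes refl with () ← trans (sym (≤ᴹ-+ᴹ e f)) e≰m
... | no _ = coeff-termMul-∤ c e q m e≰m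

termMul-cong : ∀ {n} (t : ℤ × Mono n) {q q'} → q ≋ q' → termMul t q ≋ termMul t q'
termMul-cong (c , e) {q} {q'} q≋q' = coeffwise coeff-termMul≡
  where
  coeff-termMul≡ : termMul (c , e) q ≈P termMul (c , e) q'
  coeff-termMul≡ m with e ≤ᴹ m in e≤m
  ... | true = begin
    coeff (termMul (c , e) q) m   ≡⟨ coeff-termMul c e q m e≤m ⟩
    c * coeff q (m ∸ᴹ e)          ≡⟨ cong (c *_) (coeff-≡ q≋q' (m ∸ᴹ e)) ⟩
    c * coeff q' (m ∸ᴹ e)         ≡⟨ coeff-termMul c e q' m e≤m ⟨
    coeff (termMul (c , e) q') m  ∎
    where open ≡-Reasoning
  ... | false = trans (coeff-termMul-∤ c e q m e≤m) (sym (coeff-termMul-∤ c e q' m e≤m))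

termMul-termMul : ∀ {n} c (e : Mono n) d f r →
  termMul (c , e) (termMul (d , f) r) ≡ termMul (c * d , e +ᴹ f) r
termMul-termMul c e d f r = trans (sym (LP.map-∘ r)) (LP.map-cong (λ (a , g) →
  cong₂ _,_ (sym (ZP.*-assoc c d a)) (sym (zipWith-assoc NP.+-assoc e f g))) r)

*P-congʳ : ∀ {n} (p : Poly n) {q q'} → q ≋ q' → (p *P q) ≋ (p *P q')
*P-congʳ [] _ = ≋-refl
*P-congʳ (t ∷ p) q≋q' = ++-cong (termMul-cong t q≋q') (*P-congʳ p q≋q')

*P-zeroʳ : ∀ {n} (p : Poly n) → (p *P []) ≡ []
*P-zeroʳ [] = refl
*P-zeroʳ (t ∷ p) = *P-zeroʳ p

*P-distribˡ-++ : ∀ {n} (p a b : Poly n) → (p *P (a ++ b)) ≋ ((p *P a) ++ (p *P b))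
*P-distribˡ-++ [] a b = ≋-refl
*P-distribˡ-++ (t ∷ p) a b = begin
  termMul t (a ++ b) ++ p *P (a ++ b)
    ≈⟨ ++-cong (≡⇒≋ (LP.map-++ _ a b)) (*P-distribˡ-++ p a b) ⟩
  (termMul t a ++ termMul t b) ++ (p *P a ++ p *P b)
    ≈⟨ ++-interchange (termMul t a) (termMul t b) (p *P a) (p *P b) ⟩
  (termMul t a ++ p *P a) ++ (termMul t b ++ p *P b) ∎
  where open ≋-Reasoning

*P-distribʳ-++ : ∀ {n} (a b q : Poly n) → ((a ++ b) *P q) ≡ ((a *P q) ++ (b *P q))
*P-distribʳ-++ a b q = LP.concatMap-++ _ a b

termMul-*P : ∀ {n} (t : ℤ × Mono n) q r → (termMul t q *P r) ≋ termMul t (q *P r)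
termMul-*P t [] r = ≋-refl
termMul-*P (c , e) ((d , f) ∷ q) r = begin
  termMul (c * d , e +ᴹ f) r ++ termMul (c , e) q *P r
    ≈⟨ ++-cong (≡⇒≋ (sym (termMul-termMul c e d f r))) (termMul-*P (c , e) q r) ⟩
  termMul (c , e) (termMul (d , f) r) ++ termMul (c , e) (q *P r)
    ≡⟨ LP.map-++ _ (termMul (d , f) r) (q *P r) ⟨
  termMul (c , e) (termMul (d , f) r ++ q *P r) ∎
  where open ≋-Reasoning

*P-assoc : ∀ {n} (p q r : Poly n) → ((p *P q) *P r) ≋ (p *P (q *P r))
*P-assoc [] q r = ≋-refl
*P-assoc (t ∷ p) q r = begin
  (termMul t q ++ p *P q) *P r        ≡⟨ *P-distribʳ-++ (termMul t q) (p *P q) r ⟩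
  termMul t q *P r ++ (p *P q) *P r   ≈⟨ ++-cong (termMul-*P t q r) (*P-assoc p q r) ⟩
  termMul t (q *P r) ++ p *P (q *P r) ∎
  where open ≋-Reasoning

monomial : ∀ {n} → Mono n → Poly n
monomial e = (1ℤ , e) ∷ []

monomial-*P : ∀ {n} (e : Mono n) p → (monomial e *P p) ≡ termMul (1ℤ , e) p
monomial-*P e p = LP.++-identityʳ (termMul (1ℤ , e) p)

coeff-monomial-*P : ∀ {n} (e : Mono n) p m →
  coeff (monomial e *P p) m ≡ (if e ≤ᴹ m then coeff p (m ∸ᴹ e) else 0ℤ)
coeff-monomial-*P e p m rewrite monomial-*P e p with e ≤ᴹ m in e≤m
... | true = trans (coeff-termMul 1ℤ e p m e≤m) (ZP.*-identityˡ _)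
... | false = coeff-termMul-∤ 1ℤ e p m e≤m

monomial-0ᴹ-*P : ∀ {n} (p : Poly n) → (monomial 0ᴹ *P p) ≋ p
monomial-0ᴹ-*P p = coeffwise λ m → begin
  coeff (monomial 0ᴹ *P p) m                   ≡⟨ coeff-monomial-*P 0ᴹ p m ⟩
  (if 0ᴹ ≤ᴹ m then coeff p (m ∸ᴹ 0ᴹ) else 0ℤ)  ≡⟨ cong (if_then coeff p (m ∸ᴹ 0ᴹ) else 0ℤ) (0ᴹ-≤ᴹ m) ⟩
  coeff p (m ∸ᴹ 0ᴹ)                            ≡⟨ cong (coeff p) (∸ᴹ-0ᴹ m) ⟩
  coeff p m                                    ∎
  where open ≡-Reasoning

sumℤ : ∀ {A : Set} → (A → ℤ) → List A → ℤ
sumℤ G = foldr (λ a s → G a + s) 0ℤ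

module _ {A : Set} {G : A → ℤ} {x : A} (G-vanishes : ∀ a → ¬ a ≡ x → G a ≡ 0ℤ) where

  sumℤ-delta-∉ : ∀ {xs} → x ∉ xs → sumℤ G xs ≡ 0ℤ
  sumℤ-delta-∉ {[]} _ = refl
  sumℤ-delta-∉ {a ∷ as} x∉ =
    cong₂ _+_ (G-vanishes a (λ a≡x → x∉ (here (sym a≡x)))) (sumℤ-delta-∉ (x∉ ∘ there))

  sumℤ-delta-∈ : ∀ {xs} → Unique xs → x ∈ xs → sumℤ G xs ≡ G x
  sumℤ-delta-∈ (x∉as ∷ _) (here refl) =
    trans (cong (G x +_) (sumℤ-delta-∉ (All¬⇒¬Any x∉as))) (ZP.+-identityʳ (G x))
  sumℤ-delta-∈ {a ∷ as} (a∉as ∷ as-unique) (there x∈as) =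
    trans (cong₂ _+_ (G-vanishes a (λ a≡x → All¬⇒¬Any a∉as (subst (_∈ as) (sym a≡x) x∈as)))
                     (sumℤ-delta-∈ as-unique x∈as))
          (ZP.+-identityˡ (G x))

sumP : ∀ {n} {A : Set} → (A → Poly n) → List A → Poly n
sumP f = foldr (λ a acc → f a ++ acc) []

coeff-sumP : ∀ {n} {A : Set} (f : A → Poly n) as m →
  coeff (sumP f as) m ≡ sumℤ (λ a → coeff (f a) m) as
coeff-sumP f [] m = refl
coeff-sumP f (a ∷ as) m = trans (coeff-++ (f a) _ m) (cong (coeff (f a) m +_) (coeff-sumP f as m))

sumP-zero : ∀ {n} {A : Set} (as : List A) → sumP {n} (λ _ → []) as ≡ []
sumP-zero [] = refl
sumP-zero (_ ∷ as) = sumP-zero as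

sumP-cong : ∀ {n} {A : Set} {f f' : A → Poly n} → (∀ a → f a ≋ f' a) → ∀ as → sumP f as ≋ sumP f' as
sumP-cong f≋f' [] = ≋-refl
sumP-cong f≋f' (a ∷ as) = ++-cong (f≋f' a) (sumP-cong f≋f' as)

sumP-++ : ∀ {n} {A : Set} (f f' : A → Poly n) as →
  sumP (λ a → f a ++ f' a) as ≋ (sumP f as ++ sumP f' as)
sumP-++ f f' [] = ≋-refl
sumP-++ f f' (a ∷ as) = begin
  (f a ++ f' a) ++ sumP (λ a → f a ++ f' a) as  ≈⟨ ++-cong ≋-refl (sumP-++ f f' as) ⟩
  (f a ++ f' a) ++ (sumP f as ++ sumP f' as)    ≈⟨ ++-interchange (f a) (f' a) (sumP f as) (sumP f' as) ⟩
  (f a ++ sumP f as) ++ (f' a ++ sumP f' as)    ∎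
  where open ≋-Reasoning

*P-sumP : ∀ {n} {A : Set} (q : Poly n) (f : A → Poly n) as →
  (q *P sumP f as) ≋ sumP (λ a → q *P f a) as
*P-sumP q f [] = ≡⇒≋ (*P-zeroʳ q)
*P-sumP q f (a ∷ as) = ≋-trans (*P-distribˡ-++ q (f a) (sumP f as)) (++-cong ≋-refl (*P-sumP q f as))

module IdealMembership {n k : ℕ} (g : Fin k → Poly n) where

  combination : (Fin k → Poly n) → Poly n
  combination c = ΣP (λ i → c i *P g i)

  ∈Ideal⇒≋ : ∀ p → (p∈ : p ∈Ideal g) → p ≋ combination (proj₁ p∈)
  ∈Ideal⇒≋ p (_ , p≈) = coeffwise p≈

  ∈Ideal-resp-≋ : ∀ {p q} → p ≋ q → q ∈Ideal g → p ∈Ideal g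
  ∈Ideal-resp-≋ {q = q} p≋q q∈@(c , _) = c , coeff-≡ (≋-trans p≋q (∈Ideal⇒≋ q q∈))

  []-∈Ideal : [] ∈Ideal g
  []-∈Ideal = (λ _ → []) , coeff-≡ (≡⇒≋ (sym (sumP-zero (allFin k))))

  ++-∈Ideal : ∀ p q → p ∈Ideal g → q ∈Ideal g → (p ++ q) ∈Ideal g
  ++-∈Ideal p q p∈@(c , _) q∈@(c' , _) = (λ i → c i ++ c' i) , coeff-≡ (begin
    p ++ q
      ≈⟨ ++-cong (∈Ideal⇒≋ p p∈) (∈Ideal⇒≋ q q∈) ⟩
    combination c ++ combination c'
      ≈⟨ sumP-++ (λ i → c i *P g i) (λ i → c' i *P g i) (allFin k) ⟨
    sumP (λ i → c i *P g i ++ c' i *P g i) (allFin k)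
      ≈⟨ sumP-cong (λ i → ≡⇒≋ (sym (*P-distribʳ-++ (c i) (c' i) (g i)))) (allFin k) ⟩
    combination (λ i → c i ++ c' i) ∎)
    where open ≋-Reasoning

  *P-∈Ideal : ∀ q p → p ∈Ideal g → (q *P p) ∈Ideal g
  *P-∈Ideal q p p∈@(c , _) = (λ i → q *P c i) , coeff-≡ (begin
    q *P p                                     ≈⟨ *P-congʳ q (∈Ideal⇒≋ p p∈) ⟩
    q *P combination c                         ≈⟨ *P-sumP q (λ i → c i *P g i) (allFin k) ⟩
    sumP (λ i → q *P (c i *P g i)) (allFin k)
      ≈⟨ sumP-cong (λ i → ≋-sym (*P-assoc q (c i) (g i))) (allFin k) ⟩
    combination (λ i → q *P c i)               ∎)
    where open ≋-Reasoning

  sumP-∈Ideal : ∀ {A : Set} (f : A → Poly n) as → (∀ a → f a ∈Ideal g) → sumP f as ∈Ideal g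
  sumP-∈Ideal f [] _ = []-∈Ideal
  sumP-∈Ideal f (a ∷ as) f∈ = ++-∈Ideal (f a) (sumP f as) (f∈ a) (sumP-∈Ideal f as f∈)

  generator-∈Ideal : ∀ j → g j ∈Ideal g
  generator-∈Ideal j = δ , λ m → sym (begin
    coeff (combination δ) m                       ≡⟨ coeff-sumP (λ i → δ i *P g i) (allFin k) m ⟩
    sumℤ (λ i → coeff (δ i *P g i) m) (allFin k)
      ≡⟨ sumℤ-delta-∈ (δ-vanishes m) (allFin⁺ k) (∈-allFin j) ⟩
    coeff (δ j *P g j) m                          ≡⟨ δ-diag m ⟩
    coeff (g j) m                                 ∎)
    where
    open ≡-Reasoning
    δ : Fin k → Poly n
    δ i = if does (i F.≟ j) then monomial 0ᴹ else []
    δ-vanishes : ∀ m i → ¬ i ≡ j → coeff (δ i *P g i) m ≡ 0ℤ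
    δ-vanishes m i i≢j with i F.≟ j
    ... | yes i≡j = ⊥-elim (i≢j i≡j)
    ... | no _ = refl
    δ-diag : ∀ m → coeff (δ j *P g j) m ≡ coeff (g j) m
    δ-diag m with j F.≟ j
    ... | yes _ = coeff-≡ (monomial-0ᴹ-*P (g j)) m
    ... | no j≢j = ⊥-elim (j≢j refl)

∈Ideal-⊆ : ∀ {n k l} (g : Fin k → Poly n) (g' : Fin l → Poly n) →
  (∀ i → g i ∈Ideal g') → ∀ p → p ∈Ideal g → p ∈Ideal g'
∈Ideal-⊆ {k = k} g g' g⊆g' p p∈@(c , _) =
  ∈Ideal-resp-≋ (IdealMembership.∈Ideal⇒≋ g p p∈)
    (sumP-∈Ideal (λ i → c i *P g i) (allFin k) (λ i → *P-∈Ideal (c i) (g i) (g⊆g' i)))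
  where open IdealMembership g'

isMonomialOf : ∀ {n} → ℕ → ℕ → Mono n → Bool
isMonomialOf d k e = (V.sum e ≡ᵇ d) ∧ zerosBelow k e

-- ẽ_d(k+1,…,n); the index k is a natural number so that it may run past the
-- last variable, where ẽ_{d+1} vanishes.
eTildeFrom : ∀ {n} → ℕ → ℕ → Poly n
eTildeFrom {n} d k = L.map (1ℤ ,_) (filterᵇ (isMonomialOf d k) (allVecs n d))

indicator : Bool → ℤ
indicator b = if b then 1ℤ else 0ℤ

indicator-∧-false : ∀ b → indicator (b ∧ false) ≡ 0ℤ
indicator-∧-false b = cong indicator (∧-zeroʳ b)

multiplicity : ∀ {n} → List (Mono n) → Mono n → ℤ
multiplicity V = coeff (L.map (1ℤ ,_) V)

multiplicity-∷-≡ : ∀ {n} (v : Mono n) V m → v ≡ m → multiplicity (v ∷ V) m ≡ 1ℤ + multiplicity V m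
multiplicity-∷-≡ v V m v≡m with ≡-dec N._≟_ v m
... | yes _ = refl
... | no v≢m = ⊥-elim (v≢m v≡m)

multiplicity-∷-≢ : ∀ {n} (v : Mono n) V m → ¬ v ≡ m → multiplicity (v ∷ V) m ≡ multiplicity V m
multiplicity-∷-≢ v V m v≢m with ≡-dec N._≟_ v m
... | yes v≡m = ⊥-elim (v≢m v≡m)
... | no _ = refl

multiplicity-++ : ∀ {n} (V W : List (Mono n)) m →
  multiplicity (V ++ W) m ≡ multiplicity V m + multiplicity W m
multiplicity-++ V W m =
  trans (cong (λ r → coeff r m) (LP.map-++ (1ℤ ,_) V W))
        (coeff-++ (L.map (1ℤ ,_) V) (L.map (1ℤ ,_) W) m)

multiplicity-concatMap : ∀ {n} {A : Set} (f : A → List (Mono n)) as m →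
  multiplicity (concatMap f as) m ≡ sumℤ (λ a → multiplicity (f a) m) as
multiplicity-concatMap f [] m = refl
multiplicity-concatMap f (a ∷ as) m =
  trans (multiplicity-++ (f a) (concatMap f as) m)
        (cong (multiplicity (f a) m +_) (multiplicity-concatMap f as m))

multiplicity-map-∷-same : ∀ {n} a (V : List (Mono n)) m →
  multiplicity (L.map (a ∷_) V) (a ∷ m) ≡ multiplicity V m
multiplicity-map-∷-same a [] m = refl
multiplicity-map-∷-same a (v ∷ V) m = by-cases (≡-dec N._≟_ v m)
  where
  open ≡-Reasoning
  by-cases : Dec (v ≡ m) → multiplicity (L.map (a ∷_) (v ∷ V)) (a ∷ m) ≡ multiplicity (v ∷ V) m
  by-cases (yes v≡m) = begin
    multiplicity ((a ∷ v) ∷ L.map (a ∷_) V) (a ∷ m)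
      ≡⟨ multiplicity-∷-≡ (a ∷ v) (L.map (a ∷_) V) (a ∷ m) (cong (a ∷_) v≡m) ⟩
    1ℤ + multiplicity (L.map (a ∷_) V) (a ∷ m)
      ≡⟨ cong (1ℤ +_) (multiplicity-map-∷-same a V m) ⟩
    1ℤ + multiplicity V m
      ≡⟨ multiplicity-∷-≡ v V m v≡m ⟨
    multiplicity (v ∷ V) m ∎
  by-cases (no v≢m) = begin
    multiplicity ((a ∷ v) ∷ L.map (a ∷_) V) (a ∷ m)
      ≡⟨ multiplicity-∷-≢ (a ∷ v) (L.map (a ∷_) V) (a ∷ m) (v≢m ∘ proj₂ ∘ ∷-injective) ⟩
    multiplicity (L.map (a ∷_) V) (a ∷ m)
      ≡⟨ multiplicity-map-∷-same a V m ⟩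
    multiplicity V m
      ≡⟨ multiplicity-∷-≢ v V m v≢m ⟨
    multiplicity (v ∷ V) m ∎

multiplicity-map-∷-other : ∀ {n} a x (V : List (Mono n)) m → ¬ a ≡ x →
  multiplicity (L.map (a ∷_) V) (x ∷ m) ≡ 0ℤ
multiplicity-map-∷-other a x [] m _ = refl
multiplicity-map-∷-other a x (v ∷ V) m a≢x =
  trans (multiplicity-∷-≢ (a ∷ v) (L.map (a ∷_) V) (x ∷ m) (a≢x ∘ proj₁ ∘ ∷-injective))
        (multiplicity-map-∷-other a x V m a≢x)

multiplicity-allVecs : ∀ n d (m : Mono n) → V.sum m ≤ d → multiplicity (allVecs n d) m ≡ 1ℤ
multiplicity-allVecs zero d [] _ = refl
multiplicity-allVecs (suc n) d (x ∷ m) x+Σm≤d = begin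
  multiplicity (allVecs (suc n) d) (x ∷ m)
    ≡⟨ multiplicity-concatMap (λ a → L.map (a ∷_) (allVecs n d)) (upTo (suc d)) (x ∷ m) ⟩
  sumℤ (λ a → multiplicity (L.map (a ∷_) (allVecs n d)) (x ∷ m)) (upTo (suc d))
    ≡⟨ sumℤ-delta-∈ (λ a a≢x → multiplicity-map-∷-other a x (allVecs n d) m a≢x)
                    (upTo⁺ (suc d)) (∈-upTo⁺ (s≤s (NP.m+n≤o⇒m≤o x x+Σm≤d))) ⟩
  multiplicity (L.map (x ∷_) (allVecs n d)) (x ∷ m)
    ≡⟨ multiplicity-map-∷-same x (allVecs n d) m ⟩
  multiplicity (allVecs n d) m
    ≡⟨ multiplicity-allVecs n d m (NP.m+n≤o⇒n≤o x x+Σm≤d) ⟩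
  1ℤ ∎
  where open ≡-Reasoning

multiplicity-filterᵇ : ∀ {n} (P : Mono n → Bool) V m →
  multiplicity (filterᵇ P V) m ≡ (if P m then multiplicity V m else 0ℤ)
multiplicity-filterᵇ P [] m with P m
... | true = refl
... | false = refl
multiplicity-filterᵇ P (v ∷ V) m with P v in Pv
... | true with ≡-dec N._≟_ v m
...   | yes refl rewrite Pv =
  cong (1ℤ +_) (trans (multiplicity-filterᵇ P V v) (cong (if_then multiplicity V v else 0ℤ) Pv))
...   | no _ = multiplicity-filterᵇ P V m
multiplicity-filterᵇ P (v ∷ V) m | false with ≡-dec N._≟_ v m
...   | yes refl rewrite Pv =
  trans (multiplicity-filterᵇ P V v) (cong (if_then multiplicity V v else 0ℤ) Pv)
...   | no _ = multiplicity-filterᵇ P V m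

coeff-eTildeFrom : ∀ {n} d k (m : Mono n) → coeff (eTildeFrom d k) m ≡ indicator (isMonomialOf d k m)
coeff-eTildeFrom {n} d k m
  with isMonomialOf d k m in m∈ | multiplicity-filterᵇ (isMonomialOf d k) (allVecs n d) m
... | true | multiplicity≡ = trans multiplicity≡ (multiplicity-allVecs n d m (NP.≤-reflexive Σm≡d))
  where
  Σm≡d : V.sum m ≡ d
  Σm≡d = NP.≡ᵇ⇒≡ (V.sum m) d (Equivalence.from T-≡ (∧-conicalˡ _ _ m∈))
... | false | multiplicity≡ = multiplicity≡

isMonomialOf-pascal : ∀ {n} d k (m : Mono n) → k < n →
  indicator (isMonomialOf (suc d) k m)
    ≡ indicator (isMonomialOf (suc d) (suc k) m)
      + (if xᴹ k ≤ᴹ m then indicator (isMonomialOf d k (m ∸ᴹ xᴹ k)) else 0ℤ)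
isMonomialOf-pascal d zero (zero ∷ m) _ = sym (ZP.+-identityʳ _)
isMonomialOf-pascal d zero (suc x ∷ m) _ rewrite 0ᴹ-≤ᴹ m | ∸ᴹ-0ᴹ m =
  sym (trans (cong (_+ indicator (b ∧ true)) (indicator-∧-false b)) (ZP.+-identityˡ _))
  where
  b : Bool
  b = x N.+ V.sum m ≡ᵇ d
isMonomialOf-pascal d (suc k) (zero ∷ m) (s≤s k<n) = isMonomialOf-pascal d k m k<n
isMonomialOf-pascal d (suc k) (suc x ∷ m) _ with xᴹ k ≤ᴹ m
... | true = trans (indicator-∧-false b) (sym (cong₂ _+_ (indicator-∧-false b) (indicator-∧-false _)))
  where
  b : Bool
  b = suc x N.+ V.sum m ≡ᵇ suc d
... | false = trans (indicator-∧-false b) (sym (cong (_+ 0ℤ) (indicator-∧-false b)))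
  where
  b : Bool
  b = suc x N.+ V.sum m ≡ᵇ suc d

zerosBelow⇒sum≡0 : ∀ {n} k (m : Mono n) → n ≤ k → zerosBelow k m ≡ true → V.sum m ≡ 0
zerosBelow⇒sum≡0 k [] _ _ = refl
zerosBelow⇒sum≡0 (suc k) (x ∷ m) (s≤s n≤k) zb
  rewrite NP.≡ᵇ⇒≡ x 0 (Equivalence.from T-≡ (∧-conicalˡ _ _ zb)) =
  zerosBelow⇒sum≡0 k m n≤k (∧-conicalʳ _ _ zb)

eTildeFrom-empty : ∀ {n} d k → n ≤ k → eTildeFrom {n} (suc d) k ≋ []
eTildeFrom-empty d k n≤k = coeffwise λ m → trans (coeff-eTildeFrom (suc d) k m) (vanishes m)
  where
  vanishes : ∀ m → indicator (isMonomialOf (suc d) k m) ≡ 0ℤ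
  vanishes m with zerosBelow k m in zb
  ... | true rewrite zerosBelow⇒sum≡0 k m n≤k zb = refl
  ... | false = indicator-∧-false _

eTildeFrom-pascal : ∀ {n} d k → k < n →
  eTildeFrom {n} (suc d) k ≋ (eTildeFrom (suc d) (suc k) ++ monomial (xᴹ k) *P eTildeFrom d k)
eTildeFrom-pascal d k k<n = coeffwise λ m → begin
  coeff (eTildeFrom (suc d) k) m
    ≡⟨ coeff-eTildeFrom (suc d) k m ⟩
  indicator (isMonomialOf (suc d) k m)
    ≡⟨ isMonomialOf-pascal d k m k<n ⟩
  indicator (isMonomialOf (suc d) (suc k) m)
    + (if xᴹ k ≤ᴹ m then indicator (isMonomialOf d k (m ∸ᴹ xᴹ k)) else 0ℤ)
    ≡⟨ cong₂ _+_ (coeff-eTildeFrom (suc d) (suc k) m)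
                 (trans (coeff-monomial-*P (xᴹ k) (eTildeFrom d k) m)
                        (cong (if xᴹ k ≤ᴹ m then_else 0ℤ) (coeff-eTildeFrom d k (m ∸ᴹ xᴹ k)))) ⟨
  coeff (eTildeFrom (suc d) (suc k)) m + coeff (monomial (xᴹ k) *P eTildeFrom d k) m
    ≡⟨ coeff-++ (eTildeFrom (suc d) (suc k)) (monomial (xᴹ k) *P eTildeFrom d k) m ⟨
  coeff (eTildeFrom (suc d) (suc k) ++ monomial (xᴹ k) *P eTildeFrom d k) m ∎
  where open ≡-Reasoning

degTupleℕ : ∀ {n} → (Fin n → ℕ) → ℕ → ℕ
degTupleℕ {n} h k = suc k ∸ length (filterᵇ (λ j → h j <ᵇ suc k) (allFin n))

length-filterᵇ-mono : ∀ {A : Set} (P Q : A → Bool) xs → (∀ a → T (P a) → T (Q a)) →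
  length (filterᵇ P xs) ≤ length (filterᵇ Q xs)
length-filterᵇ-mono P Q [] _ = z≤n
length-filterᵇ-mono P Q (x ∷ xs) P⇒Q with P x in Px | Q x in Qx
... | true | true = s≤s (length-filterᵇ-mono P Q xs P⇒Q)
... | true | false = ⊥-elim (subst T Qx (P⇒Q x (subst T (sym Px) tt)))
... | false | true = NP.m≤n⇒m≤1+n (length-filterᵇ-mono P Q xs P⇒Q)
... | false | false = length-filterᵇ-mono P Q xs P⇒Q

suc-∸-≤ : ∀ a b → suc a ∸ b ≤ suc (a ∸ b)
suc-∸-≤ a b =
  NP.m≤n+o⇒m∸n≤o (suc a) b (subst (suc a ≤_) (sym (NP.+-suc b (a ∸ b))) (s≤s (NP.m≤n+m∸n a b)))

degTupleℕ-suc : ∀ {n} (h : Fin n → ℕ) k → degTupleℕ h (suc k) ≤ suc (degTupleℕ h k)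
degTupleℕ-suc {n} h k =
  NP.≤-trans (NP.∸-monoʳ-≤ (suc (suc k)) more-below) (suc-∸-≤ (suc k) (below (suc k)))
  where
  below : ℕ → ℕ
  below l = length (filterᵇ (λ j → h j <ᵇ l) (allFin n))
  more-below : below (suc k) ≤ below (suc (suc k))
  more-below = length-filterᵇ-mono _ _ (allFin n)
    (λ j → NP.<⇒<ᵇ ∘ NP.m<n⇒m<1+n ∘ NP.<ᵇ⇒< (h j) (suc k))

module _ {n : ℕ} (h : Fin n → ℕ) where
  open IdealMembership (Jgens h)

  remaining⇒< : ∀ r k → suc (r N.+ k) ≡ n → k < n
  remaining⇒< r k 1+r+k≡n = subst (k <_) 1+r+k≡n (s≤s (NP.m≤n+m k r))

  eTildeFrom-∈J : ∀ d r k → suc (r N.+ k) ≡ n → degTupleℕ h k ≤ d → eTildeFrom d k ∈J h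
  eTildeFrom-∈J d r k 1+r+k≡n β≤d with NP.m≤n⇒m<n∨m≡n β≤d
  ... | inj₂ refl = subst (λ i → eTildeFrom (degTupleℕ h i) i ∈J h) (FP.toℕ-fromℕ< k<n)
                          (generator-∈Ideal (fromℕ< k<n))
    where
    k<n : k < n
    k<n = remaining⇒< r k 1+r+k≡n
  eTildeFrom-∈J zero r k _ _ | inj₁ ()
  eTildeFrom-∈J (suc d) r k 1+r+k≡n _ | inj₁ (s≤s β≤d) =
    ∈Ideal-resp-≋ (eTildeFrom-pascal d k k<n)
      (++-∈Ideal (eTildeFrom (suc d) (suc k)) (monomial (xᴹ k) *P eTildeFrom d k)
        (from-next-variable r 1+r+k≡n)
        (*P-∈Ideal (monomial (xᴹ k)) (eTildeFrom d k) (eTildeFrom-∈J d r k 1+r+k≡n β≤d)))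
    where
    k<n : k < n
    k<n = remaining⇒< r k 1+r+k≡n
    from-next-variable : ∀ r → suc (r N.+ k) ≡ n → eTildeFrom (suc d) (suc k) ∈J h
    from-next-variable zero 1+k≡n =
      ∈Ideal-resp-≋ (eTildeFrom-empty d (suc k) (NP.≤-reflexive (sym 1+k≡n))) []-∈Ideal
    from-next-variable (suc r) 2+r+k≡n =
      eTildeFrom-∈J (suc d) r (suc k) (trans (cong suc (NP.+-suc r k)) 2+r+k≡n)
        (NP.≤-trans (degTupleℕ-suc h k) (s≤s β≤d))

  eTilde-∈J : ∀ i d → degTuple h i ≤ d → eTilde d i ∈J h
  eTilde-∈J i d = eTildeFrom-∈J d (n ∸ suc (toℕ i)) (toℕ i)
    (trans (sym (NP.+-suc (n ∸ suc (toℕ i)) (toℕ i))) (NP.m∸n+n≡m (FP.toℕ<n i)))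

theorem5p3 : (n : ℕ) (h' : Fin n → ℕ) → IsHessenberg n h' →
    ((i : Fin n) (d : ℕ) → degTuple h' i < d → eTilde d i ∈J h')
    × ((h : Fin n → ℕ) → IsHessenberg n h → degTuple h >β degTuple h' →
         (p : Poly n) → p ∈J h → p ∈J h')
theorem5p3 n h' _ =
  (λ i d β'<d → eTilde-∈J h' i d (NP.<⇒≤ β'<d)) ,
  λ h _ (β≥β' , _) →
    ∈Ideal-⊆ (Jgens h) (Jgens h') (λ i → eTilde-∈J h' i (degTuple h i) (β≥β' i))
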